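{- Let $G=(V,E)$ be a connected simple bridgeless triangle-free cubic graph. Then the graph $\mathfrak{L}_2(G)$ is $4$-regular and connected.
   Context: For a simple graph $H$, its line graph $\mathcal{L}(H)$ has vertex set $E(H)$, two edges of $H$ being adjacent in $\mathcal{L}(H)$ iff they share exactly one endpoint. For a triangle $T$ of $\mathcal{L}(G)$, its three edges are pairwise adjacent vertices of $\mathcal{L}(\mathcal{L}(G))$ and hence span a triangle $\mathcal{L}(T)$ of $\mathcal{L}(\mathcal{L}(G))$. Let $\mathcal{T}_{\mathcal{L}(\mathcal{L}(G))}=\{\mathcal{L}(T): T \text{ a triangle of } \mathcal{L}(G)\}$. The reduced order two line graph $\mathfrak{L}_2(G)$ is the graph with the same vertex set as $\mathcal{L}(\mathcal{L}(G))$ and edge set the edges of $\mathcal{L}(\mathcal{L}(G))$ minus all edges of triangles in $\mathcal{T}_{\mathcal{L}(\mathcal{L}(G))}$. -}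

module Defs where

open import Data.Nat using (ℕ; zero; suc; _+_; _<ᵇ_; _≡ᵇ_)
open import Data.Bool using (Bool; true; false; _∧_; _∨_; not; if_then_else_)
open import Data.Fin using (Fin; toℕ)
open import Data.List using (List; []; _∷_; length; lookup; allFin; concatMap; map; filterᵇ)
open import Data.Bool.ListAction using (any)
open import Data.Product using (_×_; _,_; proj₁; proj₂)
open import Relation.Binary.PropositionalEquality using (_≡_)
open import Data.Empty using (⊥)
open import Relation.Nullary using (¬_)

record Graph : Set where
  constructor mkGraph
  field
    n   : ℕ
    adj : Fin n → Fin n → Bool
open Graph public

record Simple (H : Graph) : Set where
  field
    sym    : ∀ i j → adj H i j ≡ adj H j i
    irrefl : ∀ i → adj H i i ≡ false

_==_ : ∀ {n} → Fin n → Fin n → Bool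
i == j = toℕ i ≡ᵇ toℕ j

edges : (H : Graph) → List (Fin (n H) × Fin (n H))
edges H = filterᵇ (λ p → (toℕ (proj₁ p) <ᵇ toℕ (proj₂ p)) ∧ adj H (proj₁ p) (proj₂ p))
                  (concatMap (λ i → map (λ j → (i , j)) (allFin (n H))) (allFin (n H)))

memPair : ∀ {m} → Fin m → Fin m × Fin m → Bool
memPair x (c , d) = (x == c) ∨ (x == d)

b2n : Bool → ℕ
b2n true  = 1
b2n false = 0

shareOne : ∀ {m} → Fin m × Fin m → Fin m × Fin m → Bool
shareOne (a , b) e = (b2n (memPair a e) + b2n (memPair b e)) ≡ᵇ 1

-- Line graph: vertices are the edges of H (indexed by position in 'edges H'),
-- adjacent iff they share exactly one endpoint.
L : Graph → Graph
L H = mkGraph (length (edges H))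
              (λ x y → shareOne (lookup (edges H) x) (lookup (edges H) y))

samePair : ∀ {m} → Fin m × Fin m → Fin m → Fin m → Bool
samePair (p , q) a b = ((p == a) ∧ (q == b)) ∨ ((p == b) ∧ (q == a))

isTriEdge : ∀ {m} → Fin m × Fin m → Fin m → Fin m → Fin m → Bool
isTriEdge e a b c = samePair e a b ∨ samePair e b c ∨ samePair e a c

anyFin : (m : ℕ) → (Fin m → Bool) → Bool
anyFin m f = any f (allFin m)

-- x , y (vertices of L(L(G)), i.e. edges of L(G)) are both edges of L(T)
-- for some triangle T = {a,b,c} of L(G).
inTriangle : (G : Graph) → Fin (n (L (L G))) → Fin (n (L (L G))) → Bool
inTriangle G x y =
  anyFin (n (L G)) λ a → anyFin (n (L G)) λ b → anyFin (n (L G)) λ c →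
    adj (L G) a b ∧ adj (L G) b c ∧ adj (L G) a c
    ∧ isTriEdge (lookup (edges (L G)) x) a b c
    ∧ isTriEdge (lookup (edges (L G)) y) a b c

L₂ : Graph → Graph
L₂ G = mkGraph (n (L (L G))) (λ x y → adj (L (L G)) x y ∧ not (inTriangle G x y))

degree : (H : Graph) → Fin (n H) → ℕ
degree H v = length (filterᵇ (adj H v) (allFin (n H)))

Regular : ℕ → Graph → Set
Regular d H = ∀ v → degree H v ≡ d

Cubic : Graph → Set
Cubic = Regular 3

data Walk (H : Graph) : Fin (n H) → Fin (n H) → Set where
  here : ∀ {u} → Walk H u u
  step : ∀ {u v w} → adj H u v ≡ true → Walk H v w → Walk H u w

Connected : Graph → Set
Connected H = ∀ u v → Walk H u v

TriangleFree : Graph → Set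
TriangleFree H = ∀ a b c → adj H a b ≡ true → adj H b c ≡ true → adj H a c ≡ true → ⊥

deleteEdge : (H : Graph) → Fin (n H) → Fin (n H) → Graph
deleteEdge H u v = mkGraph (n H) (λ x y → adj H x y ∧ not (samePair (x , y) u v))

IsBridge : (H : Graph) → Fin (n H) → Fin (n H) → Set
IsBridge H u v = adj H u v ≡ true × ¬ Walk (deleteEdge H u v) u v

Bridgeless : Graph → Set
Bridgeless H = ∀ u v → ¬ IsBridge H u v

-- A vertex x of 𝔏₂(G) is an edge of L(G), i.e. an angle u – v – w of G: two edges e = vu and
-- f = vw with u ≠ w. In L(L(G)) it has six neighbours: the two other angles at v, and the four
-- angles v – u – t and v – w – t continuing an arm of x beyond its far end. As G is cubic and
-- triangle-free, the triangles of L(G) are exactly the stars of the vertices of G, so 𝔏₂(G) loses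
-- the edges between angles at a common vertex and keeps the four continuations: it is 4-regular.
-- Two angles at a vertex share an arm and are joined through a continuation of it, and a
-- continuation moves the apex along an edge of G, so connectivity of G lifts to 𝔏₂(G).
module Submission where

open import Defs
open import Data.Bool using (Bool; true; false; _∧_; _∨_; not)
open import Data.Bool.Properties using (T-≡; ⇔→≡)
open import Data.Empty using (⊥-elim)
open import Data.Fin using (Fin; toℕ; zero; suc)
open import Data.Fin.Properties using (toℕ-injective)
open import Data.List using (List; []; _∷_; length; lookup; allFin; concatMap; map; filterᵇ; _++_; cartesianProduct)
open import Data.List.Membership.Propositional using (_∈_)
open import Data.List.Membership.Propositional.Properties
  using (∈-filter⁺; ∈-filter⁻; ∈-lookup; ∈-allFin; ∈-cartesianProduct⁺)
open import Data.List.Membership.Propositional.Properties.WithK using (unique∧set⇒bag)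
open import Data.List.Relation.Binary.BagAndSetEquality using (∼bag⇒↭)
open import Data.List.Relation.Binary.Permutation.Propositional.Properties using (↭-length)
import Data.List.Relation.Unary.All as All
open import Data.List.Relation.Unary.All using ([]; _∷_)
open import Data.List.Relation.Unary.AllPairs using ([]; _∷_)
open import Data.List.Relation.Unary.Any as Any using (here; there; index; satisfied)
open import Data.List.Relation.Unary.Any.Properties using (lookup-index; any⁺; any⁻)
open import Data.List.Relation.Unary.Unique.Propositional using (Unique)
open import Data.List.Relation.Unary.Unique.Propositional.Properties using (filter⁺; allFin⁺; cartesianProduct⁺)
open import Data.Nat using (_<_; _<ᵇ_)
open import Data.Nat.Properties using (≡ᵇ⇒≡; ≡⇒≡ᵇ; <ᵇ⇒<; <⇒<ᵇ; <-irrefl; <-asym; <-cmp)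
open import Data.Product using (_×_; _,_; proj₁; proj₂; Σ; ∃)
open import Data.Product using () renaming (map₂ to map-proof)
open import Data.Sum using (_⊎_; inj₁; inj₂; [_,_]′)
open import Function.Base using (_∘_; case_of_)
open import Function.Bundles using (Equivalence; mk⇔)
open import Relation.Binary.Definitions using (tri<; tri≈; tri>)
open import Relation.Binary.PropositionalEquality using (_≡_; _≢_; refl; sym; trans; cong; cong₂; subst; ≢-sym)
open import Relation.Nullary using (¬_)
open import Relation.Nullary.Decidable using (T?)

open Equivalence using (to; from)

∧-true⁺ : ∀ {a b} → a ≡ true → b ≡ true → a ∧ b ≡ true
∧-true⁺ refl refl = refl

∧-true⁻ : ∀ {a b} → a ∧ b ≡ true → a ≡ true × b ≡ true
∧-true⁻ {true} h = refl , h

∨-true⁺ : ∀ {a b} → a ≡ true ⊎ b ≡ true → a ∨ b ≡ true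
∨-true⁺ (inj₁ refl) = refl
∨-true⁺ {true}  (inj₂ _) = refl
∨-true⁺ {false} (inj₂ h) = h

∨-true⁻ : ∀ {a b} → a ∨ b ≡ true → a ≡ true ⊎ b ≡ true
∨-true⁻ {true}  _ = inj₁ refl
∨-true⁻ {false} h = inj₂ h

not-true⁺ : ∀ {b} → b ≢ true → not b ≡ true
not-true⁺ {true}  h = ⊥-elim (h refl)
not-true⁺ {false} _ = refl

not-true⁻ : ∀ {b} → not b ≡ true → b ≢ true
not-true⁻ {false} _ ()

==-true⁻ : ∀ {m} (i j : Fin m) → (i == j) ≡ true → i ≡ j
==-true⁻ i j h = toℕ-injective (≡ᵇ⇒≡ (toℕ i) (toℕ j) (from T-≡ h))

==-refl : ∀ {m} (i : Fin m) → (i == i) ≡ true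
==-refl i = to T-≡ (≡⇒≡ᵇ (toℕ i) (toℕ i) refl)

==-false⁻ : ∀ {m} (i j : Fin m) → (i == j) ≡ false → i ≢ j
==-false⁻ i .i eq refl with () ← trans (sym (==-refl i)) eq

==-false : ∀ {m} {i j : Fin m} → i ≢ j → (i == j) ≡ false
==-false {i = i} {j} i≢j with i == j in eq
... | true  = ⊥-elim (i≢j (==-true⁻ i j eq))
... | false = refl

Joins : {A : Set} → A × A → A → A → Set
Joins p a b = p ≡ (a , b) ⊎ p ≡ (b , a)

Joins-sym : ∀ {A : Set} {p : A × A} {a b} → Joins p a b → Joins p b a
Joins-sym (inj₁ eq) = inj₂ eq
Joins-sym (inj₂ eq) = inj₁ eq

Joins-unique : ∀ {A : Set} {p : A × A} {a b c d} → Joins p a b → Joins p c d →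
  (a ≡ c × b ≡ d) ⊎ (a ≡ d × b ≡ c)
Joins-unique (inj₁ refl) (inj₁ refl) = inj₁ (refl , refl)
Joins-unique (inj₁ refl) (inj₂ refl) = inj₂ (refl , refl)
Joins-unique (inj₂ refl) (inj₁ refl) = inj₂ (refl , refl)
Joins-unique (inj₂ refl) (inj₂ refl) = inj₁ (refl , refl)

Joins-endpoint : ∀ {A : Set} {p : A × A} {a b c d} → Joins p a b → Joins p c d → c ≡ a ⊎ c ≡ b
Joins-endpoint ja jc with Joins-unique ja jc
... | inj₁ (refl , _) = inj₁ refl
... | inj₂ (_ , refl) = inj₂ refl

Joins-determines : ∀ {A : Set} {p : A × A} {a b c} → Joins p a b → Joins p a c → b ≡ c
Joins-determines jb jc with Joins-unique jb jc
... | inj₁ (_ , b≡c) = b≡c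
... | inj₂ (refl , refl) = refl

Proper : {A : Set} → A × A → Set
Proper p = proj₁ p ≢ proj₂ p

Joins-≢ : ∀ {A : Set} {p : A × A} {a b} → Proper p → Joins p a b → a ≢ b
Joins-≢ a≢b (inj₁ refl) = a≢b
Joins-≢ a≢b (inj₂ refl) = ≢-sym a≢b

pair-≡ : ∀ {m} {p q a b : Fin m} → (p == a) ≡ true × (q == b) ≡ true → (p , q) ≡ (a , b)
pair-≡ {p = p} {q} {a} {b} (pa , qb) = cong₂ _,_ (==-true⁻ p a pa) (==-true⁻ q b qb)

samePair⁺ : ∀ {m} {p : Fin m × Fin m} {a b} → Joins p a b → samePair p a b ≡ true
samePair⁺ {a = a} {b} (inj₁ refl) = ∨-true⁺ (inj₁ (∧-true⁺ (==-refl a) (==-refl b)))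
samePair⁺ {a = a} {b} (inj₂ refl) = ∨-true⁺ (inj₂ (∧-true⁺ (==-refl b) (==-refl a)))

samePair⁻ : ∀ {m} {p : Fin m × Fin m} {a b} → samePair p a b ≡ true → Joins p a b
samePair⁻ {p = p , q} {a} {b} h with ∨-true⁻ {(p == a) ∧ (q == b)} h
... | inj₁ h′ = inj₁ (pair-≡ (∧-true⁻ {p == a} h′))
... | inj₂ h′ = inj₂ (pair-≡ (∧-true⁻ {p == b} h′))

record Wedge {A : Set} (P Q : A × A) : Set where
  constructor wedge
  field
    apex left right : A
    joinsˡ  : Joins P apex left
    joinsʳ  : Joins Q apex right
    left≢right : left ≢ right

Wedge-swap : ∀ {A : Set} {P Q : A × A} → Wedge P Q → Wedge Q P
Wedge-swap (wedge v u w jP jQ u≢w) = wedge v w u jQ jP (≢-sym u≢w)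

shareOne⁻ : ∀ {m} (P Q : Fin m × Fin m) → Proper P → Proper Q → shareOne P Q ≡ true → Wedge P Q
shareOne⁻ (a , b) (c , d) a≢b c≢d h with a == c in ac | a == d in ad | b == c in bc | b == d in bd
... | true  | true  | _     | _     = ⊥-elim (c≢d (trans (sym (==-true⁻ a c ac)) (==-true⁻ a d ad)))
... | _     | _     | true  | true  = ⊥-elim (c≢d (trans (sym (==-true⁻ b c bc)) (==-true⁻ b d bd)))
... | true  | false | true  | false = ⊥-elim (a≢b (trans (==-true⁻ a c ac) (sym (==-true⁻ b c bc))))
... | false | true  | false | true  = ⊥-elim (a≢b (trans (==-true⁻ a d ad) (sym (==-true⁻ b d bd))))
... | true  | false | false | false with refl ← ==-true⁻ a c ac = wedge a b d (inj₁ refl) (inj₁ refl) (==-false⁻ b d bd)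
... | false | true  | false | false with refl ← ==-true⁻ a d ad = wedge a b c (inj₁ refl) (inj₂ refl) (==-false⁻ b c bc)
... | false | false | true  | false with refl ← ==-true⁻ b c bc = wedge b a d (inj₂ refl) (inj₁ refl) (==-false⁻ a d ad)
... | false | false | false | true  with refl ← ==-true⁻ b d bd = wedge b a c (inj₂ refl) (inj₂ refl) (==-false⁻ a c ac)
... | true  | false | false | true  with () ← h
... | false | true  | true  | false with () ← h
... | false | false | false | false with () ← h

shareOne⁺ : ∀ {m} {P Q : Fin m × Fin m} → Proper P → Proper Q → Wedge P Q → shareOne P Q ≡ true
shareOne⁺ pP pQ (wedge v u w jP jQ u≢w) = oriented (Joins-≢ pP jP) (Joins-≢ pQ jQ) jP jQ
  where
  oriented : ∀ {P Q} → v ≢ u → v ≢ w → Joins P v u → Joins Q v w → shareOne P Q ≡ true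
  oriented v≢u v≢w (inj₁ refl) (inj₁ refl)
    rewrite ==-refl v | ==-false (≢-sym v≢u) | ==-false u≢w = refl
  oriented v≢u v≢w (inj₁ refl) (inj₂ refl)
    rewrite ==-refl v | ==-false v≢w | ==-false (≢-sym v≢u) | ==-false u≢w = refl
  oriented v≢u v≢w (inj₂ refl) (inj₁ refl)
    rewrite ==-refl v | ==-false (≢-sym v≢u) | ==-false u≢w = refl
  oriented v≢u v≢w (inj₂ refl) (inj₂ refl)
    rewrite ==-refl v | ==-false v≢w | ==-false (≢-sym v≢u) | ==-false u≢w = refl

shareOne-sym : ∀ {m} (P Q : Fin m × Fin m) → Proper P → Proper Q → shareOne P Q ≡ shareOne Q P
shareOne-sym P Q pP pQ = ⇔→≡ (mk⇔ (flipped P Q pP pQ) (flipped Q P pQ pP))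
  where
  flipped : ∀ P Q → Proper P → Proper Q → shareOne P Q ≡ true → shareOne Q P ≡ true
  flipped P Q pP pQ = shareOne⁺ pQ pP ∘ Wedge-swap ∘ shareOne⁻ P Q pP pQ

shareOne-irrefl : ∀ {m} (P : Fin m × Fin m) → Proper P → shareOne P P ≡ false
shareOne-irrefl (a , b) a≢b rewrite ==-refl a | ==-refl b | ==-false (≢-sym a≢b) = refl

lookup-injective : ∀ {A : Set} (xs : List A) → Unique xs → ∀ i j → lookup xs i ≡ lookup xs j → i ≡ j
lookup-injective (x ∷ xs) u         zero    zero    eq = refl
lookup-injective (x ∷ xs) (x∉ ∷ u)  zero    (suc j) eq = ⊥-elim (All.lookup x∉ (∈-lookup j) eq)
lookup-injective (x ∷ xs) (x∉ ∷ u)  (suc i) zero    eq = ⊥-elim (All.lookup x∉ (∈-lookup i) (sym eq))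
lookup-injective (x ∷ xs) (x∉ ∷ u)  (suc i) (suc j) eq = cong suc (lookup-injective xs u i j eq)

concatMap-pairs : ∀ {A B : Set} (xs : List A) (ys : List B) →
  concatMap (λ x → map (x ,_) ys) xs ≡ cartesianProduct xs ys
concatMap-pairs []       ys = refl
concatMap-pairs (x ∷ xs) ys = cong (map (x ,_) ys ++_) (concatMap-pairs xs ys)

module EdgeList (H : Graph) where

  V : Set
  V = Fin (n H)

  Edge : Set
  Edge = Fin (length (edges H))

  ends : Edge → V × V
  ends = lookup (edges H)

  private
    isEdge : V × V → Bool
    isEdge p = (toℕ (proj₁ p) <ᵇ toℕ (proj₂ p)) ∧ adj H (proj₁ p) (proj₂ p)

    pairs : List (V × V)
    pairs = concatMap (λ i → map (i ,_) (allFin (n H))) (allFin (n H))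

    isEdge-ends : ∀ e → isEdge (ends e) ≡ true
    isEdge-ends e = to T-≡ (proj₂ (∈-filter⁻ (T? ∘ isEdge) {xs = pairs} (∈-lookup e)))

  ends-ordered : ∀ e → toℕ (proj₁ (ends e)) < toℕ (proj₂ (ends e))
  ends-ordered e = <ᵇ⇒< _ _ (from T-≡ (proj₁ (∧-true⁻ (isEdge-ends e))))

  ends-adj : ∀ e → adj H (proj₁ (ends e)) (proj₂ (ends e)) ≡ true
  ends-adj e = proj₂ (∧-true⁻ {toℕ (proj₁ (ends e)) <ᵇ toℕ (proj₂ (ends e))} (isEdge-ends e))

  ends-proper : ∀ e → Proper (ends e)
  ends-proper e eq = <-irrefl (cong toℕ eq) (ends-ordered e)

  edges-unique : Unique (edges H)
  edges-unique = filter⁺ (T? ∘ isEdge)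
    (subst Unique (sym (concatMap-pairs (allFin (n H)) (allFin (n H))))
      (cartesianProduct⁺ (allFin⁺ (n H)) (allFin⁺ (n H))))

  ends-injective : ∀ {e f} → ends e ≡ ends f → e ≡ f
  ends-injective = lookup-injective (edges H) edges-unique _ _

  private
    ordered : ∀ {e a b} → ends e ≡ (a , b) → toℕ a < toℕ b
    ordered {e} eq = subst (λ p → toℕ (proj₁ p) < toℕ (proj₂ p)) eq (ends-ordered e)

  Joins-injective : ∀ {e f a b} → Joins (ends e) a b → Joins (ends f) a b → e ≡ f
  Joins-injective (inj₁ je) (inj₁ jf) = ends-injective (trans je (sym jf))
  Joins-injective (inj₂ je) (inj₂ jf) = ends-injective (trans je (sym jf))
  Joins-injective (inj₁ je) (inj₂ jf) = ⊥-elim (<-asym (ordered je) (ordered jf))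
  Joins-injective (inj₂ je) (inj₁ jf) = ⊥-elim (<-asym (ordered je) (ordered jf))

  Joins-adj : Simple H → ∀ {e a b} → Joins (ends e) a b → adj H a b ≡ true
  Joins-adj SH {e} (inj₁ refl) = ends-adj e
  Joins-adj SH {e} (inj₂ refl) = trans (Simple.sym SH _ _) (ends-adj e)

  private
    ordered-edge : ∀ {a b} → toℕ a < toℕ b → adj H a b ≡ true → Σ Edge λ e → ends e ≡ (a , b)
    ordered-edge {a} {b} a<b ab = index ab∈edges , sym (lookup-index ab∈edges)
      where
      ab∈edges : (a , b) ∈ edges H
      ab∈edges = ∈-filter⁺ (T? ∘ isEdge) {xs = pairs}
        (subst ((a , b) ∈_) (sym (concatMap-pairs (allFin (n H)) (allFin (n H))))
          (∈-cartesianProduct⁺ (∈-allFin a) (∈-allFin b)))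
        (from T-≡ (∧-true⁺ (to T-≡ (<⇒<ᵇ a<b)) ab))

  edge-joining : Simple H → ∀ {a b} → adj H a b ≡ true → Σ Edge λ e → Joins (ends e) a b
  edge-joining SH {a} {b} ab with <-cmp (toℕ a) (toℕ b)
  ... | tri< a<b _ _ = let (e , eq) = ordered-edge a<b ab in e , inj₁ eq
  ... | tri≈ _ a≡b _ with refl ← toℕ-injective a≡b with () ← trans (sym ab) (Simple.irrefl SH a)
  ... | tri> _ _ b<a = let (e , eq) = ordered-edge b<a (trans (Simple.sym SH b a) ab) in e , inj₂ eq

L-simple : ∀ H → Simple (L H)
L-simple H = record
  { sym    = λ e f → shareOne-sym (ends e) (ends f) (ends-proper e) (ends-proper f)
  ; irrefl = λ e → shareOne-irrefl (ends e) (ends-proper e)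
  }
  where open EdgeList H

neighbourList : (H : Graph) → Fin (n H) → List (Fin (n H))
neighbourList H v = filterᵇ (adj H v) (allFin (n H))

module _ (H : Graph) (v : Fin (n H)) where

  neighbourList-unique : Unique (neighbourList H v)
  neighbourList-unique = filter⁺ (T? ∘ adj H v) (allFin⁺ (n H))

  ∈-neighbourList⁻ : ∀ {t} → t ∈ neighbourList H v → adj H v t ≡ true
  ∈-neighbourList⁻ t∈ = to T-≡ (proj₂ (∈-filter⁻ (T? ∘ adj H v) {xs = allFin (n H)} t∈))

  ∈-neighbourList⁺ : ∀ {t} → adj H v t ≡ true → t ∈ neighbourList H v
  ∈-neighbourList⁺ {t} vt = ∈-filter⁺ (T? ∘ adj H v) (∈-allFin t) (from T-≡ vt)

  degree-≡-length : ∀ {xs} → Unique xs → (∀ {t} → t ∈ xs → adj H v t ≡ true) →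
    (∀ {t} → adj H v t ≡ true → t ∈ xs) → degree H v ≡ length xs
  degree-≡-length {xs} unique sound complete = ↭-length (∼bag⇒↭ (unique∧set⇒bag neighbourList-unique unique
    (mk⇔ (complete ∘ ∈-neighbourList⁻) (∈-neighbourList⁺ ∘ sound))))

record Neighbours (H : Graph) (v a b c : Fin (n H)) : Set where
  field
    a≢b : a ≢ b
    a≢c : a ≢ c
    b≢c : b ≢ c
    adj-a : adj H v a ≡ true
    adj-b : adj H v b ≡ true
    adj-c : adj H v c ≡ true
    only : ∀ {t} → adj H v t ≡ true → t ≡ a ⊎ t ≡ b ⊎ t ≡ c

module _ {H : Graph} {v : Fin (n H)} where

  Neighbours-swap₁₂ : ∀ {a b c} → Neighbours H v a b c → Neighbours H v b a c
  Neighbours-swap₁₂ N = record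
    { a≢b = ≢-sym a≢b ; a≢c = b≢c ; b≢c = a≢c ; adj-a = adj-b ; adj-b = adj-a ; adj-c = adj-c
    ; only = λ vt → [ inj₂ ∘ inj₁ , [ inj₁ , inj₂ ∘ inj₂ ]′ ]′ (only vt) }
    where open Neighbours N

  Neighbours-swap₂₃ : ∀ {a b c} → Neighbours H v a b c → Neighbours H v a c b
  Neighbours-swap₂₃ N = record
    { a≢b = a≢c ; a≢c = a≢b ; b≢c = ≢-sym b≢c ; adj-a = adj-a ; adj-b = adj-c ; adj-c = adj-b
    ; only = λ vt → [ inj₁ , [ inj₂ ∘ inj₂ , inj₂ ∘ inj₁ ]′ ]′ (only vt) }
    where open Neighbours N

module _ (H : Graph) {v : Fin (n H)} where

  three-neighbours : degree H v ≡ 3 → ∃ λ a → ∃ λ b → ∃ λ c → Neighbours H v a b c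
  three-neighbours deg =
    triple (neighbourList H v) deg (neighbourList-unique H v) (∈-neighbourList⁻ H v) (∈-neighbourList⁺ H v)
    where
    triple : (xs : List (Fin (n H))) → length xs ≡ 3 → Unique xs → (∀ {t} → t ∈ xs → adj H v t ≡ true) →
      (∀ {t} → adj H v t ≡ true → t ∈ xs) → ∃ λ a → ∃ λ b → ∃ λ c → Neighbours H v a b c
    triple (a ∷ b ∷ c ∷ []) refl ((a≢b ∷ a≢c ∷ []) ∷ (b≢c ∷ []) ∷ [] ∷ []) sound complete =
      a , b , c , record
        { a≢b = a≢b ; a≢c = a≢c ; b≢c = b≢c
        ; adj-a = sound (here refl) ; adj-b = sound (there (here refl)) ; adj-c = sound (there (there (here refl)))
        ; only = λ vt → case complete vt of λ
            { (here eq)                 → inj₁ eq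
            ; (there (here eq))         → inj₂ (inj₁ eq)
            ; (there (there (here eq))) → inj₂ (inj₂ eq)
            }
        }

  other-neighbours : degree H v ≡ 3 → ∀ {u} → adj H v u ≡ true → ∃ λ w → ∃ λ z → Neighbours H v u w z
  other-neighbours deg vu with three-neighbours deg
  ... | a , b , c , N with Neighbours.only N vu
  ... | inj₁ refl = b , c , N
  ... | inj₂ (inj₁ refl) = a , c , Neighbours-swap₁₂ N
  ... | inj₂ (inj₂ refl) = a , b , Neighbours-swap₁₂ (Neighbours-swap₂₃ N)

  third-neighbour : degree H v ≡ 3 → ∀ {u w} → adj H v u ≡ true → adj H v w ≡ true → u ≢ w →
    ∃ λ z → Neighbours H v u w z
  third-neighbour deg vu vw u≢w with other-neighbours deg vu
  ... | a , b , N with Neighbours.only N vw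
  ... | inj₁ refl = ⊥-elim (u≢w refl)
  ... | inj₂ (inj₁ refl) = b , N
  ... | inj₂ (inj₂ refl) = a , Neighbours-swap₂₃ N

anyFin⁻ : ∀ {m} (p : Fin m → Bool) → anyFin m p ≡ true → Σ (Fin m) λ i → p i ≡ true
anyFin⁻ p h = map-proof (to T-≡) (satisfied (any⁻ p (allFin _) (from T-≡ h)))

anyFin⁺ : ∀ {m} (p : Fin m → Bool) i → p i ≡ true → anyFin m p ≡ true
anyFin⁺ p i pi = to T-≡ (any⁺ p (Any.map (λ { refl → from T-≡ pi }) (∈-allFin i)))

anyFin³⁻ : ∀ {m} (p : Fin m → Fin m → Fin m → Bool) →
  anyFin m (λ a → anyFin m λ b → anyFin m λ c → p a b c) ≡ true →
  Σ (Fin m) λ a → Σ (Fin m) λ b → Σ (Fin m) λ c → p a b c ≡ true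
anyFin³⁻ p h
  with a , h₁ ← anyFin⁻ _ h
  with b , h₂ ← anyFin⁻ _ h₁
  with c , h₃ ← anyFin⁻ _ h₂ = a , b , c , h₃

isTriEdge⁻ : ∀ {m} {P : Fin m × Fin m} {a b c} → isTriEdge P a b c ≡ true →
  Joins P a b ⊎ Joins P b c ⊎ Joins P a c
isTriEdge⁻ {P = P} {a} {b} h with ∨-true⁻ {samePair P a b} h
... | inj₁ ab = inj₁ (samePair⁻ ab)
... | inj₂ h′ with ∨-true⁻ {samePair P b _} h′
...   | inj₁ bc = inj₂ (inj₁ (samePair⁻ bc))
...   | inj₂ ac = inj₂ (inj₂ (samePair⁻ ac))

isTriEdge⁺ : ∀ {m} {P : Fin m × Fin m} {a b c} → Joins P a b ⊎ Joins P b c ⊎ Joins P a c →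
  isTriEdge P a b c ≡ true
isTriEdge⁺ {P = P} {a} {b} {c} (inj₁ ab) = ∨-true⁺ {samePair P a b} (inj₁ (samePair⁺ ab))
isTriEdge⁺ {P = P} {a} {b} {c} (inj₂ bc⊎ac) = ∨-true⁺ {samePair P a b} (inj₂ (∨-true⁺ {samePair P b c}
  ([ inj₁ ∘ samePair⁺ , inj₂ ∘ samePair⁺ ]′ bc⊎ac)))

triangle-corner : ∀ {m} {P : Fin m × Fin m} {a b c p q} → isTriEdge P a b c ≡ true → Joins P p q →
  q ≡ a ⊎ q ≡ b ⊎ q ≡ c
triangle-corner h jpq with isTriEdge⁻ h
... | inj₁ jab = [ inj₁ , inj₂ ∘ inj₁ ]′ (Joins-endpoint jab (Joins-sym jpq))
... | inj₂ (inj₁ jbc) = [ inj₂ ∘ inj₁ , inj₂ ∘ inj₂ ]′ (Joins-endpoint jbc (Joins-sym jpq))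
... | inj₂ (inj₂ jac) = [ inj₁ , inj₂ ∘ inj₂ ]′ (Joins-endpoint jac (Joins-sym jpq))

corners-adjacent : ∀ (H : Graph) → Simple H → ∀ {a b c p q} →
  adj H a b ≡ true → adj H b c ≡ true → adj H a c ≡ true →
  p ≡ a ⊎ p ≡ b ⊎ p ≡ c → q ≡ a ⊎ q ≡ b ⊎ q ≡ c → p ≢ q → adj H p q ≡ true
corners-adjacent H SH ab bc ac (inj₁ refl)        (inj₂ (inj₁ refl)) _ = ab
corners-adjacent H SH ab bc ac (inj₁ refl)        (inj₂ (inj₂ refl)) _ = ac
corners-adjacent H SH ab bc ac (inj₂ (inj₁ refl)) (inj₂ (inj₂ refl)) _ = bc
corners-adjacent H SH ab bc ac (inj₂ (inj₁ refl)) (inj₁ refl)        _ = trans (Simple.sym SH _ _) ab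
corners-adjacent H SH ab bc ac (inj₂ (inj₂ refl)) (inj₁ refl)        _ = trans (Simple.sym SH _ _) ac
corners-adjacent H SH ab bc ac (inj₂ (inj₂ refl)) (inj₂ (inj₁ refl)) _ = trans (Simple.sym SH _ _) bc
corners-adjacent H SH ab bc ac (inj₁ refl)        (inj₁ refl)        p≢q = ⊥-elim (p≢q refl)
corners-adjacent H SH ab bc ac (inj₂ (inj₁ refl)) (inj₂ (inj₁ refl)) p≢q = ⊥-elim (p≢q refl)
corners-adjacent H SH ab bc ac (inj₂ (inj₂ refl)) (inj₂ (inj₂ refl)) p≢q = ⊥-elim (p≢q refl)

module _ (G : Graph) where

  open EdgeList (L G) using () renaming (ends to ends₂)

  record SharedTriangle (x y : Fin (n (L (L G)))) : Set where
    constructor triangle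
    field
      a b c  : Fin (n (L G))
      ab     : adj (L G) a b ≡ true
      bc     : adj (L G) b c ≡ true
      ac     : adj (L G) a c ≡ true
      x-side : isTriEdge (ends₂ x) a b c ≡ true
      y-side : isTriEdge (ends₂ y) a b c ≡ true

  inTriangle⁻ : ∀ {x y} → inTriangle G x y ≡ true → SharedTriangle x y
  inTriangle⁻ {x} {y} h = split (anyFin³⁻ test h)
    where
    test : Fin (n (L G)) → Fin (n (L G)) → Fin (n (L G)) → Bool
    test a b c = adj (L G) a b ∧ adj (L G) b c ∧ adj (L G) a c
               ∧ isTriEdge (ends₂ x) a b c ∧ isTriEdge (ends₂ y) a b c

    split : (∃ λ a → ∃ λ b → ∃ λ c → test a b c ≡ true) → SharedTriangle x y
    split (a , b , c , h₃) =
      let ab , h₄ = ∧-true⁻ {adj (L G) a b} h₃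
          bc , h₅ = ∧-true⁻ {adj (L G) b c} h₄
          ac , h₆ = ∧-true⁻ {adj (L G) a c} h₅
          x-side , y-side = ∧-true⁻ {isTriEdge (ends₂ x) a b c} h₆
      in triangle a b c ab bc ac x-side y-side

  inTriangle⁺ : ∀ {x y} → SharedTriangle x y → inTriangle G x y ≡ true
  inTriangle⁺ (triangle a b c ab bc ac x-side y-side) =
    anyFin⁺ _ a (anyFin⁺ _ b (anyFin⁺ _ c
      (∧-true⁺ ab (∧-true⁺ bc (∧-true⁺ ac (∧-true⁺ x-side y-side))))))

  SharedTriangle-sym : ∀ {x y} → SharedTriangle x y → SharedTriangle y x
  SharedTriangle-sym (triangle a b c ab bc ac x-side y-side) = triangle a b c ab bc ac y-side x-side

  inTriangle-sym : ∀ {x y} → inTriangle G x y ≡ true → inTriangle G y x ≡ true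
  inTriangle-sym = inTriangle⁺ ∘ SharedTriangle-sym ∘ inTriangle⁻

  shared-triangle-closes : ∀ {x y e f h} → Joins (ends₂ x) e f → Joins (ends₂ y) e h → f ≢ h →
    SharedTriangle x y → adj (L G) f h ≡ true
  shared-triangle-closes x≈ef y≈eh f≢h (triangle a b c ab bc ac x-side y-side) =
    corners-adjacent (L G) (L-simple G) ab bc ac (triangle-corner x-side x≈ef) (triangle-corner y-side y≈eh) f≢h

  L₂-sym : ∀ {x y} → adj (L₂ G) x y ≡ true → adj (L₂ G) y x ≡ true
  L₂-sym {x} {y} h =
    let xy , not-tri = ∧-true⁻ {adj (L (L G)) x y} h
    in ∧-true⁺ (trans (Simple.sym (L-simple (L G)) y x) xy) (not-true⁺ (not-true⁻ not-tri ∘ inTriangle-sym))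

_++ʷ_ : ∀ {H : Graph} {a b c} → Walk H a b → Walk H b c → Walk H a c
here         ++ʷ walk′ = walk′
step ab walk ++ʷ walk′ = step ab (walk ++ʷ walk′)

module ReducedLineGraph (G : Graph) (simple : Simple G) (triangle-free : TriangleFree G) (cubic : Cubic G) where

  open EdgeList G using (V; ends-proper)
    renaming (Edge to E; ends to ends₁; Joins-injective to Joins₁-injective)
  open EdgeList (L G) using ()
    renaming (Edge to E₂; ends to ends₂; ends-proper to ends₂-proper; ends-adj to ends₂-adj;
              Joins-injective to Joins₂-injective)

  Joins₁-adj : ∀ {e a b} → Joins (ends₁ e) a b → adj G a b ≡ true
  Joins₁-adj = EdgeList.Joins-adj G simple

  Joins₂-adj : ∀ {x e f} → Joins (ends₂ x) e f → adj (L G) e f ≡ true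
  Joins₂-adj = EdgeList.Joins-adj (L G) (L-simple G)

  edge₁-joining : ∀ {a b} → adj G a b ≡ true → Σ E λ e → Joins (ends₁ e) a b
  edge₁-joining = EdgeList.edge-joining G simple

  edge₂-joining : ∀ {e f} → adj (L G) e f ≡ true → Σ E₂ λ x → Joins (ends₂ x) e f
  edge₂-joining = EdgeList.edge-joining (L G) (L-simple G)

  Joins₁-≢ : ∀ {e a b} → Joins (ends₁ e) a b → a ≢ b
  Joins₁-≢ {e} = Joins-≢ (ends-proper e)

  L-adj⁺ : ∀ {e f v u w} → Joins (ends₁ e) v u → Joins (ends₁ f) v w → u ≢ w → adj (L G) e f ≡ true
  L-adj⁺ {e} {f} e≈vu f≈vw u≢w = shareOne⁺ (ends-proper e) (ends-proper f) (wedge _ _ _ e≈vu f≈vw u≢w)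

  record Angle (x : E₂) (v : V) : Set where
    constructor angle
    field
      e f  : E
      u w  : V
      x≈ef : Joins (ends₂ x) e f
      e≈vu : Joins (ends₁ e) v u
      f≈vw : Joins (ends₁ f) v w
      u≢w  : u ≢ w

  Angle-swap : ∀ {x v} → Angle x v → Angle x v
  Angle-swap (angle e f u w x≈ef e≈vu f≈vw u≢w) = angle f e w u (Joins-sym x≈ef) f≈vw e≈vu (≢-sym u≢w)

  angle-of : ∀ x → Σ V (Angle x)
  angle-of x with wedge v u w e≈vu f≈vw u≢w ← shareOne⁻ _ _ (ends-proper _) (ends-proper _) (ends₂-adj x) =
    v , angle _ _ u w (inj₁ refl) e≈vu f≈vw u≢w

  angle-at : ∀ {e f v u w} → Joins (ends₁ e) v u → Joins (ends₁ f) v w → u ≢ w → Σ E₂ λ x → Angle x v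
  angle-at e≈vu f≈vw u≢w =
    let x , x≈ef = edge₂-joining (L-adj⁺ e≈vu f≈vw u≢w) in x , angle _ _ _ _ x≈ef e≈vu f≈vw u≢w

  record Continues (y : E₂) (e : E) (v u : V) : Set where
    constructor continues
    field
      h    : E
      t    : V
      y≈eh : Joins (ends₂ y) e h
      h≈ut : Joins (ends₁ h) u t
      t≢v  : t ≢ v

  no-wedge-across-path : ∀ {e f h v u w t} →
    Joins (ends₁ f) v w → Joins (ends₁ e) v u → Joins (ends₁ h) u t → u ≢ w → t ≢ v → ¬ Wedge (ends₁ f) (ends₁ h)
  no-wedge-across-path f≈vw e≈vu h≈ut u≢w t≢v (wedge c p q f≈cp h≈cq _)
    with Joins-unique f≈vw f≈cp | Joins-unique h≈ut h≈cq
  ... | inj₁ (refl , _) | inj₁ (refl , _) = Joins₁-≢ e≈vu refl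
  ... | inj₁ (refl , _) | inj₂ (_ , refl) = t≢v refl
  ... | inj₂ (_ , refl) | inj₁ (refl , _) = u≢w refl
  ... | inj₂ (_ , refl) | inj₂ (_ , refl) =
    triangle-free _ _ _ (Joins₁-adj e≈vu) (Joins₁-adj h≈ut) (Joins₁-adj f≈vw)

  continuation-adjacent : ∀ {x y v} (α : Angle x v) →
    Continues y (Angle.e α) v (Angle.u α) → adj (L₂ G) x y ≡ true
  continuation-adjacent {x} {y} (angle e f u w x≈ef e≈vu f≈vw u≢w) (continues h t y≈eh h≈ut t≢v) =
    ∧-true⁺ (shareOne⁺ (ends₂-proper x) (ends₂-proper y) (wedge e f h x≈ef y≈eh f≢h)) (not-true⁺ no-triangle)
    where
    f≢h : f ≢ h
    f≢h refl = [ Joins₁-≢ e≈vu , ≢-sym t≢v ]′ (Joins-endpoint h≈ut f≈vw)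

    no-triangle : inTriangle G x y ≢ true
    no-triangle = no-wedge-across-path f≈vw e≈vu h≈ut u≢w t≢v
                ∘ shareOne⁻ _ _ (ends-proper f) (ends-proper h)
                ∘ shared-triangle-closes G x≈ef y≈eh f≢h
                ∘ inTriangle⁻ G

  star-triangle : ∀ {x y e f g v u w z} → Joins (ends₂ x) e f → Joins (ends₂ y) e g →
    Joins (ends₁ e) v u → Joins (ends₁ f) v w → Joins (ends₁ g) v z → u ≢ w → u ≢ z → w ≢ z →
    SharedTriangle G x y
  star-triangle x≈ef y≈eg e≈vu f≈vw g≈vz u≢w u≢z w≢z =
    triangle _ _ _ (L-adj⁺ e≈vu f≈vw u≢w) (L-adj⁺ f≈vw g≈vz w≢z) (L-adj⁺ e≈vu g≈vz u≢z)
      (isTriEdge⁺ (inj₁ x≈ef)) (isTriEdge⁺ (inj₂ (inj₂ y≈eg)))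

  L₂-adj⁻ : ∀ {x y} → adj (L₂ G) x y ≡ true → Wedge (ends₂ x) (ends₂ y) × ¬ SharedTriangle G x y
  L₂-adj⁻ {x} {y} h =
    let xy , not-tri = ∧-true⁻ {adj (L (L G)) x y} h
    in shareOne⁻ _ _ (ends₂-proper x) (ends₂-proper y) xy , not-true⁻ not-tri ∘ inTriangle⁺ G

  -- An L₂-neighbour of the angle x sharing its arm e must leave e at its far end u:
  -- at v it would be the third edge g, and x, y would span the triangle {e, f, g}.
  continues-through-arm : ∀ {x y v o} (α : Angle x v) → ¬ SharedTriangle G x y →
    Joins (ends₂ y) (Angle.e α) o → o ≢ Angle.f α → Continues y (Angle.e α) v (Angle.u α)
  continues-through-arm {y = y} (angle e f u w x≈ef e≈vu f≈vw u≢w) no-tri y≈eo o≢f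
    with wedge c r t e≈cr o≈ct r≢t ← shareOne⁻ _ _ (ends-proper e) (ends-proper _) (Joins₂-adj y≈eo)
    with Joins-unique e≈vu e≈cr
  ... | inj₂ (refl , refl) = continues _ t y≈eo o≈ct (≢-sym r≢t)
  ... | inj₁ (refl , refl)
    with z , N ← third-neighbour G (cubic _) (Joins₁-adj e≈vu) (Joins₁-adj f≈vw) u≢w
    with Neighbours.only N {t} (Joins₁-adj o≈ct)
  ...   | inj₁ refl        = ⊥-elim (r≢t refl)
  ...   | inj₂ (inj₁ refl) = ⊥-elim (o≢f (Joins₁-injective o≈ct f≈vw))
  ...   | inj₂ (inj₂ refl) = ⊥-elim (no-tri (star-triangle x≈ef y≈eo e≈vu f≈vw o≈ct
                                    (Neighbours.a≢b N) (Neighbours.a≢c N) (Neighbours.b≢c N)))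

  L₂-neighbour-continues : ∀ {x y v} (α : Angle x v) → adj (L₂ G) x y ≡ true →
    Continues y (Angle.e α) v (Angle.u α) ⊎ Continues y (Angle.f α) v (Angle.w α)
  L₂-neighbour-continues α = through-an-arm α ∘ L₂-adj⁻
    where
    through-an-arm : ∀ {x y v} (α : Angle x v) → Wedge (ends₂ x) (ends₂ y) × ¬ SharedTriangle G x y →
      Continues y (Angle.e α) v (Angle.u α) ⊎ Continues y (Angle.f α) v (Angle.w α)
    through-an-arm α@(angle e f u w x≈ef _ _ _) (wedge s r o x≈sr y≈so r≢o , no-tri)
      with Joins-unique x≈ef x≈sr
    ... | inj₁ (refl , refl) = inj₁ (continues-through-arm α no-tri y≈so (≢-sym r≢o))
    ... | inj₂ (refl , refl) = inj₂ (continues-through-arm (Angle-swap α) no-tri y≈so (≢-sym r≢o))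

  record Continuations (e : E) (v u : V) : Set where
    field
      y₁ y₂    : E₂
      y₁-cont  : Continues y₁ e v u
      y₂-cont  : Continues y₂ e v u
      y₁≢y₂    : y₁ ≢ y₂
      complete : ∀ {y} → Continues y e v u → y ≡ y₁ ⊎ y ≡ y₂

  Continues-angle : ∀ {y e v u} → Continues y e v u → Joins (ends₁ e) v u → Angle y u
  Continues-angle (continues h t y≈eh h≈ut t≢v) e≈vu =
    angle _ h _ t y≈eh (Joins-sym e≈vu) h≈ut (≢-sym t≢v)

  continuation : ∀ {e v u t} → Joins (ends₁ e) v u → adj G u t ≡ true → t ≢ v →
    Σ E₂ λ y → Continues y e v u
  continuation e≈vu ut t≢v =
    let h , h≈ut = edge₁-joining ut
        y , y≈eh = edge₂-joining (L-adj⁺ (Joins-sym e≈vu) h≈ut (≢-sym t≢v))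
    in y , continues h _ y≈eh h≈ut t≢v

  Continues-unique : ∀ {y y′ e v u} (c : Continues y e v u) (c′ : Continues y′ e v u) →
    Continues.t c ≡ Continues.t c′ → y ≡ y′
  Continues-unique (continues h t y≈eh h≈ut _) (continues h′ .t y′≈eh′ h′≈ut _) refl
    with refl ← Joins₁-injective h≈ut h′≈ut = Joins₂-injective y≈eh y′≈eh′

  Continues-distinct : ∀ {y y′ e v u} (c : Continues y e v u) (c′ : Continues y′ e v u) →
    Continues.t c ≢ Continues.t c′ → y ≢ y′
  Continues-distinct (continues h t y≈eh h≈ut _) (continues h′ t′ y′≈eh′ h′≈ut′ _) t≢t′ refl
    with refl ← Joins-determines y≈eh y′≈eh′ = t≢t′ (Joins-determines h≈ut h′≈ut′)

  continuations : ∀ {e v u} → Joins (ends₁ e) v u → Continuations e v u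
  continuations {e} {v} {u} e≈vu =
    let _ , _ , N = other-neighbours G (cubic u) (Joins₁-adj (Joins-sym e≈vu)) in from-neighbours N
    where
    from-neighbours : ∀ {u₁ u₂} → Neighbours G u v u₁ u₂ → Continuations e v u
    from-neighbours N = record
      { y₁ = proj₁ c₁ ; y₂ = proj₁ c₂ ; y₁-cont = proj₂ c₁ ; y₂-cont = proj₂ c₂
      ; y₁≢y₂ = Continues-distinct (proj₂ c₁) (proj₂ c₂) b≢c
      ; complete = λ c → [ ⊥-elim ∘ Continues.t≢v c
                         , [ inj₁ ∘ Continues-unique c (proj₂ c₁)
                           , inj₂ ∘ Continues-unique c (proj₂ c₂) ]′
                         ]′ (only (Joins₁-adj (Continues.h≈ut c)))
      }
      where
      open Neighbours N
      c₁ : Σ E₂ λ y → Continues y e v u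
      c₁ = continuation e≈vu adj-b (≢-sym a≢b)
      c₂ : Σ E₂ λ y → Continues y e v u
      c₂ = continuation e≈vu adj-c (≢-sym a≢c)

  arm-continuations-distinct : ∀ {x y y′ v} (α : Angle x v) →
    Continues y (Angle.e α) v (Angle.u α) → Continues y′ (Angle.f α) v (Angle.w α) → y ≢ y′
  arm-continuations-distinct (angle e f u w _ e≈vu f≈vw u≢w) (continues h t y≈eh h≈ut t≢v)
                             (continues _ _ y≈fk _ _) refl =
    [ (λ { refl → u≢w (Joins-determines e≈vu f≈vw) })
    , (λ { refl → [ Joins₁-≢ e≈vu , ≢-sym t≢v ]′ (Joins-endpoint h≈ut f≈vw) }) ]′
    (Joins-endpoint y≈eh y≈fk)

  angle-degree : ∀ {x v} (α : Angle x v) → degree (L₂ G) x ≡ 4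
  angle-degree {x} {v} α = degree-≡-length (L₂ G) x unique sound complete
    where
    open Continuations (continuations (Angle.e≈vu α)) renaming (complete to y₁-or-y₂)
    open Continuations (continuations (Angle.f≈vw α))
      renaming ( y₁ to y₃; y₂ to y₄; y₁-cont to y₃-cont; y₂-cont to y₄-cont; y₁≢y₂ to y₃≢y₄
               ; complete to y₃-or-y₄)

    distinct : ∀ {y y′} → Continues y (Angle.e α) v (Angle.u α) → Continues y′ (Angle.f α) v (Angle.w α) →
      y ≢ y′
    distinct = arm-continuations-distinct α

    unique : Unique (y₁ ∷ y₂ ∷ y₃ ∷ y₄ ∷ [])
    unique = (y₁≢y₂ ∷ distinct y₁-cont y₃-cont ∷ distinct y₁-cont y₄-cont ∷ [])
           ∷ (distinct y₂-cont y₃-cont ∷ distinct y₂-cont y₄-cont ∷ [])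
           ∷ (y₃≢y₄ ∷ []) ∷ [] ∷ []

    sound : ∀ {y} → y ∈ y₁ ∷ y₂ ∷ y₃ ∷ y₄ ∷ [] → adj (L₂ G) x y ≡ true
    sound (here refl)                         = continuation-adjacent α y₁-cont
    sound (there (here refl))                 = continuation-adjacent α y₂-cont
    sound (there (there (here refl)))         = continuation-adjacent (Angle-swap α) y₃-cont
    sound (there (there (there (here refl)))) = continuation-adjacent (Angle-swap α) y₄-cont

    complete : ∀ {y} → adj (L₂ G) x y ≡ true → y ∈ y₁ ∷ y₂ ∷ y₃ ∷ y₄ ∷ []
    complete xy = [ [ here , there ∘ here ]′ ∘ y₁-or-y₂
                  , [ there ∘ there ∘ here , there ∘ there ∘ there ∘ here ]′ ∘ y₃-or-y₄
                  ]′ (L₂-neighbour-continues α xy)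

  L₂-regular : Regular 4 (L₂ G)
  L₂-regular x = angle-degree (proj₂ (angle-of x))

  shared-arm-connected : ∀ {x y v} (α : Angle x v) (β : Angle y v) → Angle.u α ≡ Angle.u β → Walk (L₂ G) x y
  shared-arm-connected {v = v} α@(angle e _ u _ _ e≈vu _ _) β@(angle e′ _ _ _ _ e′≈vu _ _) refl =
    step (continuation-adjacent α c) (step (L₂-sym G (continuation-adjacent β c′)) here)
    where
    open Continuations (continuations e≈vu) using (y₁; y₁-cont)
    c : Continues y₁ e v u
    c = y₁-cont
    c′ : Continues y₁ e′ v u
    c′ = subst (λ e → Continues y₁ e v u) (Joins₁-injective e≈vu e′≈vu) c

  angles-at-vertex-connected : ∀ {x y v} → Angle x v → Angle y v → Walk (L₂ G) x y
  angles-at-vertex-connected {x} {y} α β =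
    let _ , N = third-neighbour G (cubic _) (Joins₁-adj (e≈vu α)) (Joins₁-adj (f≈vw α)) (u≢w α)
    in by-arms (Neighbours.only N (Joins₁-adj (e≈vu β))) (Neighbours.only N (Joins₁-adj (f≈vw β)))
    where
    open Angle
    by-arms : ∀ {z} → u β ≡ u α ⊎ u β ≡ w α ⊎ u β ≡ z → w β ≡ u α ⊎ w β ≡ w α ⊎ w β ≡ z →
      Walk (L₂ G) x y
    by-arms (inj₁ u′≡u)        _                  = shared-arm-connected α β (sym u′≡u)
    by-arms (inj₂ (inj₁ u′≡w)) _                  = shared-arm-connected (Angle-swap α) β (sym u′≡w)
    by-arms _                  (inj₁ w′≡u)        = shared-arm-connected α (Angle-swap β) (sym w′≡u)
    by-arms _                  (inj₂ (inj₁ w′≡w)) = shared-arm-connected (Angle-swap α) (Angle-swap β) (sym w′≡w)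
    by-arms (inj₂ (inj₂ u′≡z)) (inj₂ (inj₂ w′≡z)) = ⊥-elim (u≢w β (trans u′≡z (sym w′≡z)))

  angles-connected : ∀ {v v′} → Walk G v v′ → ∀ {x y} → Angle x v → Angle y v′ → Walk (L₂ G) x y
  angles-connected here α β = angles-at-vertex-connected α β
  angles-connected {v} (step {v = t} vt walk) α β =
    let c , c≈vt = edge₁-joining vt
        _ , _ , N = other-neighbours G (cubic v) vt
        c′ , c′≈va = edge₁-joining (Neighbours.adj-b N)
        _ , α′ = angle-at c≈vt c′≈va (Neighbours.a≢b N)
        cont = Continuations.y₁-cont (continuations c≈vt)
    in angles-at-vertex-connected α α′ ++ʷ
       step (continuation-adjacent α′ cont) (angles-connected walk (Continues-angle cont c≈vt) β)

  L₂-connected : Connected G → Connected (L₂ G)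
  L₂-connected connected x y = angles-connected (connected _ _) (proj₂ (angle-of x)) (proj₂ (angle-of y))

proposition2p1 : (G : Graph) → Simple G → Connected G → Bridgeless G → TriangleFree G → Cubic G →
    Regular 4 (L₂ G) × Connected (L₂ G)
proposition2p1 G simple connected _ triangle-free cubic = L₂-regular , L₂-connected connected
  where open ReducedLineGraph G simple triangle-free cubic
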